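{- Let $\mathcal{C}$ be a class of countable labelled chains and let $\psi_1(\bar x),\dots,\psi_k(\bar x)$ be $\mathrm{MSO}$ formulas with the same tuple $\bar x$ of free first-order variables. Assume that for each $j$ the formula $\psi_j(\bar x)$ admits a $d_j$-dimensional reparameterization over $\mathcal{C}$ (given as an $\mathrm{MSO}$ formula $G_j$). Then one can effectively construct a $d$-dimensional reparameterization of $\bigvee_{j=1}^k\psi_j(\bar x)$ over $\mathcal{C}$, where $d:=\max_{1\le j\le k} d_j$.
   Context: A labelled chain is a structure $(M,<,P_1,\dots,P_m)$ with $(M,<)$ a linear order and unary predicates $P_i$; $\mathrm{MSO}$ is monadic second-order logic over this signature. A formula $G(\bar x,\bar y)$ is a reparameterization of $\psi(\bar x)$ over $\mathcal{C}$ if: (i) over $\mathcal{C}$, $\psi(\bar x)\equiv\exists\bar y\,G(\bar x,\bar y)$; (ii) $\forall\bar x\,\exists^{\le1}\bar y\,G(\bar x,\bar y)$ holds in every structure of $\mathcal{C}$; (iii) there is $N\in\mathbb{N}$ such that for every $\mathcal{M}\in\mathcal{C}$ and every tuple $\bar y$, $|\{\bar x\mid\mathcal{M}\models G(\bar x,\bar y)\}|\le N$. Its dimension is the length of $\bar y$. -}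

module Defs where

open import Level using (0ℓ)
open import Data.Nat using (ℕ; zero; suc; _+_; _⊔_)
open import Data.Fin using (Fin; zero; suc)
open import Data.Bool using (Bool; true)
open import Data.Product using (Σ; Σ-syntax; ∃; _×_; _,_)
open import Data.Sum using (_⊎_)
open import Data.Empty using (⊥)
open import Data.Vec.Functional using (Vector; _∷_; _++_)
open import Relation.Nullary using (¬_)
open import Relation.Binary.PropositionalEquality using (_≡_; _≢_)
open import Relation.Binary.Structures using (IsStrictTotalOrder)
open import Function.Definitions using (Injective)
open import Function.Base using (_∘_)

record Chain (m : ℕ) : Set₁ where
  field
    Carrier : Set
    _<_     : Carrier → Carrier → Set
    isSTO   : IsStrictTotalOrder _≡_ _<_
    label   : Fin m → Carrier → Bool

open Chain public

Countable : ∀ {m} → Chain m → Set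
Countable M = Σ (Carrier M → ℕ) λ f → Injective _≡_ _≡_ f

-- MSO formulas over the signature (<, P_0 … P_{m-1}),
-- with n free first-order and s free second-order (set) variables,
-- de Bruijn style (the bound variable of a quantifier is index zero).

data Formula (m : ℕ) : ℕ → ℕ → Set where
  ff   : ∀ {n s} → Formula m n s
  lt   : ∀ {n s} → Fin n → Fin n → Formula m n s
  eq   : ∀ {n s} → Fin n → Fin n → Formula m n s
  lab  : ∀ {n s} → Fin m → Fin n → Formula m n s
  mem  : ∀ {n s} → Fin n → Fin s → Formula m n s
  neg  : ∀ {n s} → Formula m n s → Formula m n s
  and  : ∀ {n s} → Formula m n s → Formula m n s → Formula m n s
  or   : ∀ {n s} → Formula m n s → Formula m n s → Formula m n s
  ex1  : ∀ {n s} → Formula m (suc n) s → Formula m n s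
  ex2  : ∀ {n s} → Formula m n (suc s) → Formula m n s

Sat : ∀ {m n s} (M : Chain m) → Vector (Carrier M) n → Vector (Carrier M → Bool) s
      → Formula m n s → Set
Sat M ρ σ ff        = ⊥
Sat M ρ σ (lt i j)  = _<_ M (ρ i) (ρ j)
Sat M ρ σ (eq i j)  = ρ i ≡ ρ j
Sat M ρ σ (lab p i) = label M p (ρ i) ≡ true
Sat M ρ σ (mem i k) = σ k (ρ i) ≡ true
Sat M ρ σ (neg φ)   = ¬ Sat M ρ σ φ
Sat M ρ σ (and φ ψ) = Sat M ρ σ φ × Sat M ρ σ ψ
Sat M ρ σ (or φ ψ)  = Sat M ρ σ φ ⊎ Sat M ρ σ ψ
Sat M ρ σ (ex1 φ)   = Σ (Carrier M) λ a → Sat M (a ∷ ρ) σ φ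
Sat M ρ σ (ex2 φ)   = Σ (Carrier M → Bool) λ X → Sat M ρ (X ∷ σ) φ

Sat₀ : ∀ {m n} (M : Chain m) → Formula m n 0 → Vector (Carrier M) n → Set
Sat₀ M φ ρ = Sat M ρ (λ ()) φ

-- Reparameterization.  ψ(x̄) has |x̄| = n; G(x̄,ȳ) has free variables
-- x̄ ++ ȳ with |ȳ| = d (the dimension).  A class 𝒞 is a predicate on chains.

IsReparam : ∀ {m n d} (C : Chain m → Set) → Formula m n 0 → Formula m (n + d) 0 → Set₁
IsReparam {m} {n} {d} C ψ G =
  (∀ M → C M → ∀ (x : Vector (Carrier M) n) →
     (Sat₀ M ψ x → Σ (Vector (Carrier M) d) λ y → Sat₀ M G (x ++ y))
   × (Σ (Vector (Carrier M) d) (λ y → Sat₀ M G (x ++ y)) → Sat₀ M ψ x))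
  ×
  (∀ M → C M → ∀ (x : Vector (Carrier M) n) (y y′ : Vector (Carrier M) d) →
     Sat₀ M G (x ++ y) → Sat₀ M G (x ++ y′) → ∀ i → y i ≡ y′ i)
  ×
  -- (iii) ∃N ∀𝓜∈𝒞 ∀ȳ, |{x̄ | G(x̄,ȳ)}| ≤ N
  --       (among any N+1 such tuples x̄, two coincide)
  (Σ ℕ λ N → ∀ M → C M → ∀ (y : Vector (Carrier M) d)
     (xs : Fin (suc N) → Vector (Carrier M) n) →
     (∀ k → Sat₀ M G (xs k ++ y)) →
     Σ (Fin (suc N)) λ k → Σ (Fin (suc N)) λ k′ → k ≢ k′ × (∀ i → xs k i ≡ xs k′ i))

⋁ : ∀ {m n s k} → (Fin k → Formula m n s) → Formula m n s
⋁ {k = zero}  ψ = ff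
⋁ {k = suc k} ψ = or (ψ zero) (⋁ (ψ ∘ suc))

maxF : ∀ {k} → (Fin k → ℕ) → ℕ
maxF {zero}  d = 0
maxF {suc k} d = d zero ⊔ maxF (d ∘ suc)

{-# OPTIONS --safe #-}
-- Widen each Gⱼ to the common dimension d = max dⱼ by requiring the surplus
-- witness coordinates to equal a fixed free variable x₀ (this needs n ≥ 1):
-- witnesses stay unique and fibres do not grow.  Reparameterizations of equal
-- dimension are then combined by taking the first applicable disjunct,
-- G₁ ∨ (¬ψ₁ ∧ G₂): a witness for G₁ forces ψ₁, so no x̄ has witnesses on both
-- sides, and each fibre of the combination lies in the union of a G₁-fibre and
-- a G₂-fibre, so it has at most N₁ + N₂ elements.  Excluded middle decides
-- which disjunct applies.
module Submission where

open import Defs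
open import Level using (0ℓ)
open import Data.Nat using (ℕ; zero; suc; _+_; _≤_; s≤s)
import Data.Nat as ℕ
open import Data.Nat.Properties using (_<?_; ≤-refl; ≤-trans; ≤⇒≯; ≮⇒≥; +-suc; m≤m⊔n; m≤n⊔m)
open import Data.Fin using (Fin; zero; suc; toℕ; fromℕ<; inject≤; lift; splitAt; _↑ˡ_; _↑ʳ_)
open import Data.Fin.Properties
  using (suc-injective; lift-injective; toℕ-injective; toℕ-fromℕ<; toℕ-inject≤; toℕ<n; ∀-cons-⇔)
open import Data.Bool using (Bool; true)
open import Data.Product using (Σ; ∃; ∃₂; _×_; _,_; proj₁; proj₂; map₂)
import Data.Product.Function.Dependent.Propositional as Σ
open import Data.Product.Function.NonDependent.Propositional using (_×-⇔_)
open import Data.Sum using (_⊎_; inj₁; inj₂; [_,_]′)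
import Data.Sum as Sum
open import Data.Sum.Function.Propositional using (_⊎-⇔_)
open import Data.Empty using (⊥-elim)
open import Data.Vec.Functional using (Vector; _∷_; _++_)
open import Data.Vec.Functional.Properties using (lookup-++ˡ; lookup-++ʳ)
open import Relation.Nullary using (yes; no; contradiction)
open import Relation.Binary.PropositionalEquality
  using (_≡_; _≢_; _≗_; refl; sym; trans; cong; cong₂; subst)
open import Function.Base using (_∘_)
open import Function.Bundles using (_⇔_; mk⇔; Equivalence)
open import Function.Definitions using (Injective)
open import Function.Construct.Identity using (⇔-id)
open import Function.Construct.Composition using (_⇔-∘_)
open import Function.Related.Propositional using (≡⇒)
open import Function.Related.TypeIsomorphisms using (¬-cong-⇔)
open import Relation.Unary using (Pred; _⊆_; _∪_)
open import Relation.Binary.Core using (Rel)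
open import Axiom.ExcludedMiddle using (ExcludedMiddle)

open Equivalence using (to; from)

private
  variable
    A : Set
    m n n′ s d D k N N₁ N₂ : ℕ

rename : (Fin n → Fin n′) → Formula m n s → Formula m n′ s
rename f ff        = ff
rename f (lt i j)  = lt (f i) (f j)
rename f (eq i j)  = eq (f i) (f j)
rename f (lab p i) = lab p (f i)
rename f (mem i k) = mem (f i) k
rename f (neg φ)   = neg (rename f φ)
rename f (and φ ψ) = and (rename f φ) (rename f ψ)
rename f (or φ ψ)  = or (rename f φ) (rename f ψ)
rename f (ex1 φ)   = ex1 (rename (lift 1 f) φ)
rename f (ex2 φ)   = ex2 (rename f φ)

Sat-rename : (M : Chain m) {ρ : Vector (Carrier M) n} {ρ′ : Vector (Carrier M) n′}
             {σ : Vector (Carrier M → Bool) s} (f : Fin n → Fin n′) (φ : Formula m n s) →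
             ρ′ ∘ f ≗ ρ → Sat M ρ′ σ (rename f φ) ⇔ Sat M ρ σ φ
Sat-rename M f ff        e = ⇔-id _
Sat-rename M f (lt i j)  e = ≡⇒ (cong₂ (_<_ M) (e i) (e j))
Sat-rename M f (eq i j)  e = ≡⇒ (cong₂ _≡_ (e i) (e j))
Sat-rename M f (lab p i) e = ≡⇒ (cong (λ a → label M p a ≡ true) (e i))
Sat-rename M {σ = σ} f (mem i k) e = ≡⇒ (cong (λ a → σ k a ≡ true) (e i))
Sat-rename M f (neg φ)   e = ¬-cong-⇔ (Sat-rename M f φ e)
Sat-rename M f (and φ ψ) e = Sat-rename M f φ e ×-⇔ Sat-rename M f ψ e
Sat-rename M f (or φ ψ)  e = Sat-rename M f φ e ⊎-⇔ Sat-rename M f ψ e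
Sat-rename M {ρ} {ρ′} f (ex1 φ) e =
  Σ.congˡ λ {a} → Sat-rename M {ρ = a ∷ ρ} {ρ′ = a ∷ ρ′} (lift 1 f) φ λ { zero → refl ; (suc i) → e i }
Sat-rename M f (ex2 φ)   e = Σ.congˡ (Sat-rename M f φ e)

weaken : Formula m n s → Formula m (n + D) s
weaken = rename (_↑ˡ _)

Sat-weaken : (M : Chain m) (ψ : Formula m n 0) (x : Vector (Carrier M) n) (y : Vector (Carrier M) D) →
             Sat₀ M (weaken ψ) (x ++ y) ⇔ Sat₀ M ψ x
Sat-weaken M ψ x y = Sat-rename M (_↑ˡ _) ψ (lookup-++ˡ x y)

⋀ : (Fin k → Formula m n s) → Formula m n s
⋀ {k = zero}  φ = neg ff
⋀ {k = suc k} φ = and (φ zero) (⋀ (φ ∘ suc))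

Sat-⋀ : (M : Chain m) {ρ : Vector (Carrier M) n} {σ : Vector (Carrier M → Bool) s}
        (φ : Fin k → Formula m n s) → Sat M ρ σ (⋀ φ) ⇔ (∀ j → Sat M ρ σ (φ j))
Sat-⋀ {k = zero}  M φ = mk⇔ (λ _ ()) (λ _ ())
Sat-⋀ {k = suc k} M φ = ∀-cons-⇔ ⇔-∘ (⇔-id _ ×-⇔ Sat-⋀ M (φ ∘ suc))

restrict : d ≤ D → Vector A D → Vector A d
restrict p y i = y (inject≤ i p)

padRight : A → Vector A d → Vector A D
padRight {d = d} a y j with toℕ j <? d
... | yes j<d = y (fromℕ< j<d)
... | no _    = a

Padded : ℕ → A → Vector A D → Set
Padded d a y = ∀ j → d ≤ toℕ j → y j ≡ a

inject≤-fromℕ< : ∀ {j : Fin D} (j<d : toℕ j ℕ.< d) (p : d ≤ D) → inject≤ (fromℕ< j<d) p ≡ j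
inject≤-fromℕ< j<d p = toℕ-injective (trans (toℕ-inject≤ (fromℕ< j<d) p) (toℕ-fromℕ< j<d))

restrict-padRight : (p : d ≤ D) (a : A) (y : Vector A d) → restrict p (padRight a y) ≗ y
restrict-padRight {d = d} p a y i with toℕ (inject≤ i p) <? d
... | yes i<d = cong y (toℕ-injective (trans (toℕ-fromℕ< i<d) (toℕ-inject≤ i p)))
... | no i≮d  = contradiction (subst (ℕ._< d) (sym (toℕ-inject≤ i p)) (toℕ<n i)) i≮d

padded-padRight : (a : A) (y : Vector A d) → Padded {D = D} d a (padRight a y)
padded-padRight {d = d} a y j d≤j with toℕ j <? d
... | yes j<d = contradiction j<d (≤⇒≯ d≤j)
... | no _    = refl

padded-unique : (p : d ≤ D) {a : A} {y y′ : Vector A D} →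
                Padded d a y → Padded d a y′ → restrict p y ≗ restrict p y′ → y ≗ y′
padded-unique {d = d} p {y = y} {y′} pad pad′ e j with toℕ j <? d
... | yes j<d = subst (λ i → y i ≡ y′ i) (inject≤-fromℕ< j<d p) (e (fromℕ< j<d))
... | no j≮d  = trans (pad j (≮⇒≥ j≮d)) (sym (pad′ j (≮⇒≥ j≮d)))

widenIndex : d ≤ D → Fin (n + d) → Fin (n + D)
widenIndex {n = n} p i with splitAt n i
... | inj₁ a = a ↑ˡ _
... | inj₂ b = n ↑ʳ inject≤ b p

lookup-++-widenIndex : (p : d ≤ D) (x : Vector A n) {y : Vector A D} {y′ : Vector A d} →
                       restrict p y ≗ y′ → (x ++ y) ∘ widenIndex p ≗ x ++ y′
lookup-++-widenIndex {n = n} p x {y} e i with splitAt n i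
... | inj₁ a = lookup-++ˡ x y a
... | inj₂ b = trans (lookup-++ʳ x y (inject≤ b p)) (e b)

record Selection (a : ℕ) (P : Fin n → Set) : Set where
  constructor selection
  field
    index           : Fin a → Fin n
    index-injective : Injective _≡_ _≡_ index
    index∈P         : ∀ i → P (index i)

module _ {P : Fin (suc n) → Set} where

  selection-suc : Selection k (P ∘ suc) → Selection k P
  selection-suc (selection g g-inj g∈P) = selection (suc ∘ g) (g-inj ∘ suc-injective) g∈P

  selection-cons : P zero → Selection k (P ∘ suc) → Selection (suc k) P
  selection-cons p (selection g g-inj g∈P) =
    selection (lift 1 g) (lift-injective g g-inj 1) λ { zero → p ; (suc i) → g∈P i }

selection-[] : {P : Fin n → Set} → Selection 0 P
selection-[] = selection (λ ()) (λ { {()} }) (λ ())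

pigeonhole-⊎ : ∀ a b → suc (a + b) ≤ n → {P Q : Fin n → Set} → (∀ i → P i ⊎ Q i) →
               Selection (suc a) P ⊎ Selection (suc b) Q
pigeonhole-⊎ a b (s≤s _) h with h zero
pigeonhole-⊎ zero    b _ _ | inj₁ p = inj₁ (selection-cons p selection-[])
pigeonhole-⊎ (suc a) b (s≤s a+b<n) h | inj₁ p =
  Sum.map (selection-cons p) selection-suc (pigeonhole-⊎ a b a+b<n (h ∘ suc))
pigeonhole-⊎ a zero    _ _ | inj₂ q = inj₂ (selection-cons q selection-[])
pigeonhole-⊎ {suc n} a (suc b) (s≤s a+1+b<n) h | inj₂ q =
  Sum.map selection-suc (selection-cons q)
    (pigeonhole-⊎ a b (subst (_≤ n) (+-suc a b) a+1+b<n) (h ∘ suc))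

module _ {A : Set} (_≈_ : Rel A 0ℓ) where

  AtMost : ℕ → Pred A 0ℓ → Set
  AtMost N P = ∀ (xs : Fin (suc N) → A) → (∀ i → P (xs i)) → ∃₂ λ i i′ → i ≢ i′ × xs i ≈ xs i′

  AtMost-⊆ : {P Q : Pred A 0ℓ} → P ⊆ Q → AtMost N Q → AtMost N P
  AtMost-⊆ P⊆Q |Q|≤N xs xs∈P = |Q|≤N xs (P⊆Q ∘ xs∈P)

  AtMost-∪ : {P Q : Pred A 0ℓ} → AtMost N₁ P → AtMost N₂ Q → AtMost (N₁ + N₂) (P ∪ Q)
  AtMost-∪ {N₁} {N₂} {P} {Q} |P|≤N₁ |Q|≤N₂ xs xs∈P∪Q =
    [ collide {R = P} |P|≤N₁ , collide {R = Q} |Q|≤N₂ ]′ (pigeonhole-⊎ N₁ N₂ ≤-refl xs∈P∪Q)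
    where
    collide : ∀ {N R} → AtMost N R → Selection (suc N) (R ∘ xs) → ∃₂ λ i i′ → i ≢ i′ × xs i ≈ xs i′
    collide |R|≤N (selection g g-inj g∈R) with |R|≤N (xs ∘ g) g∈R
    ... | i , i′ , i≢i′ , xsᵢ≈xsᵢ′ = g i , g i′ , i≢i′ ∘ g-inj , xsᵢ≈xsᵢ′

-- IsReparam C ψ G unfolds to Represents C ψ G × UniqueWitness C G × BoundedFibres C G.

Fibre : (M : Chain m) → Formula m (n + D) 0 → Vector (Carrier M) D → Pred (Vector (Carrier M) n) 0ℓ
Fibre M G y x = Sat₀ M G (x ++ y)

Represents : (Chain m → Set) → Formula m n 0 → Formula m (n + D) 0 → Set₁
Represents C ψ G = ∀ M → C M → ∀ x →
  (Sat₀ M ψ x → ∃ λ y → Sat₀ M G (x ++ y)) × (∃ (λ y → Sat₀ M G (x ++ y)) → Sat₀ M ψ x)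

UniqueWitness : (Chain m → Set) → Formula m (n + D) 0 → Set₁
UniqueWitness {n = n} {D = D} C G =
  ∀ M → C M → ∀ (x : Vector (Carrier M) n) (y y′ : Vector (Carrier M) D) →
  Sat₀ M G (x ++ y) → Sat₀ M G (x ++ y′) → y ≗ y′

BoundedFibres : (Chain m → Set) → Formula m (n + D) 0 → Set₁
BoundedFibres {n = n} C G = ∃ λ N → ∀ M → C M → ∀ y → AtMost _≗_ N (Fibre {n = n} M G y)

padding : Fin n → ℕ → Fin D → Formula m (n + D) 0
padding {n = n} {D = D} x₀ d j with toℕ j <? d
... | yes _ = neg ff
... | no _  = eq (n ↑ʳ j) (x₀ ↑ˡ D)

Sat-padding : (M : Chain m) (x₀ : Fin n) (d : ℕ) (x : Vector (Carrier M) n) (y : Vector (Carrier M) D) →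
              Sat₀ M (⋀ (padding x₀ d)) (x ++ y) ⇔ Padded d (x x₀) y
Sat-padding M x₀ d x y = mk⇔ (λ h j → to (padding⇔ j) (to all-padding h j))
                             (λ pad → from all-padding λ j → from (padding⇔ j) (pad j))
  where
  all-padding : Sat₀ M (⋀ (padding x₀ d)) (x ++ y) ⇔ (∀ j → Sat₀ M (padding x₀ d j) (x ++ y))
  -- σ must be given: the empty valuation inside Sat₀ mentions the formula, so it cannot be inferred.
  all-padding = Sat-⋀ M {σ = λ ()} (padding x₀ d)

  padding⇔ : ∀ j → Sat₀ M (padding x₀ d j) (x ++ y) ⇔ (d ≤ toℕ j → y j ≡ x x₀)
  padding⇔ j with toℕ j <? d
  ... | yes j<d = mk⇔ (λ _ d≤j → contradiction j<d (≤⇒≯ d≤j)) (λ _ ())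
  ... | no j≮d  = mk⇔ (λ e _ → to lookups e) (λ pad → from lookups (pad (≮⇒≥ j≮d)))
    where
    lookups : ((x ++ y) (_ ↑ʳ j) ≡ (x ++ y) (x₀ ↑ˡ _)) ⇔ (y j ≡ x x₀)
    lookups = ≡⇒ (cong₂ _≡_ (lookup-++ʳ x y j) (lookup-++ˡ x y x₀))

widen : Fin n → d ≤ D → Formula m (n + d) 0 → Formula m (n + D) 0
widen {d = d} x₀ p G = and (rename (widenIndex p) G) (⋀ (padding x₀ d))

Sat-widen : (M : Chain m) (x₀ : Fin n) (p : d ≤ D) (G : Formula m (n + d) 0)
            (x : Vector (Carrier M) n) {y : Vector (Carrier M) D} {y′ : Vector (Carrier M) d} →
            restrict p y ≗ y′ → Sat₀ M (widen x₀ p G) (x ++ y) ⇔ (Sat₀ M G (x ++ y′) × Padded d (x x₀) y)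
Sat-widen M x₀ p G x {y} e =
  Sat-rename M (widenIndex p) G (lookup-++-widenIndex p x e) ×-⇔ Sat-padding M x₀ _ x y

IsReparam-widen : {C : Chain m → Set} (x₀ : Fin n) (p : d ≤ D)
                  (ψ : Formula m n 0) (G : Formula m (n + d) 0) →
                  IsReparam C ψ G → IsReparam C ψ (widen x₀ p G)
IsReparam-widen {m} {n} {d} {D} {C} x₀ p ψ G (represents , unique , N , bounded) =
  represents′ , unique′ , bounded′
  where
  restrict-widen : (M : Chain m) {x : Vector (Carrier M) n} {y : Vector (Carrier M) D} →
                   Sat₀ M (widen x₀ p G) (x ++ y) → Sat₀ M G (x ++ restrict p y) × Padded d (x x₀) y
  restrict-widen M {x} = to (Sat-widen M x₀ p G x λ _ → refl)

  represents′ : Represents C ψ (widen x₀ p G)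
  represents′ M CM x =
    introduce , λ (y , w) → proj₂ (represents M CM x) (restrict p y , proj₁ (restrict-widen M w))
    where
    introduce : Sat₀ M ψ x → ∃ λ y → Sat₀ M (widen x₀ p G) (x ++ y)
    introduce s with proj₁ (represents M CM x) s
    ... | y , g = padRight (x x₀) y ,
                  from (Sat-widen M x₀ p G x (restrict-padRight p (x x₀) y)) (g , padded-padRight (x x₀) y)

  unique′ : UniqueWitness C (widen x₀ p G)
  unique′ M CM x y y′ w w′ with restrict-widen M w | restrict-widen M w′
  ... | g , pad | g′ , pad′ = padded-unique p pad pad′ (unique M CM x _ _ g g′)

  bounded′ : BoundedFibres C (widen x₀ p G)
  bounded′ = N , λ M CM y →
    AtMost-⊆ _≗_ (λ {x} w → proj₁ (restrict-widen M {x} w)) (bounded M CM (restrict p y))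

orElse : Formula m n 0 → Formula m (n + D) 0 → Formula m (n + D) 0 → Formula m (n + D) 0
orElse ψ₁ G₁ G₂ = or G₁ (and (neg (weaken ψ₁)) G₂)

IsReparam-or : ExcludedMiddle 0ℓ → {C : Chain m → Set}
               (ψ₁ ψ₂ : Formula m n 0) (G₁ G₂ : Formula m (n + D) 0) →
               IsReparam C ψ₁ G₁ → IsReparam C ψ₂ G₂ → IsReparam C (or ψ₁ ψ₂) (orElse ψ₁ G₁ G₂)
IsReparam-or {n = n} {D = D} lem {C} ψ₁ ψ₂ G₁ G₂
  (represents₁ , unique₁ , N₁ , bounded₁) (represents₂ , unique₂ , N₂ , bounded₂) =
  represents , unique , bounded
  where
  H : Formula _ (n + D) 0
  H = orElse ψ₁ G₁ G₂

  represents : Represents C (or ψ₁ ψ₂) H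
  represents M CM x = introduce , eliminate
    where
    introduce : Sat₀ M (or ψ₁ ψ₂) x → ∃ λ y → Sat₀ M H (x ++ y)
    introduce s with lem {Sat₀ M ψ₁ x} | s
    ... | yes s₁ | _       = map₂ inj₁ (proj₁ (represents₁ M CM x) s₁)
    ... | no ¬s₁ | inj₁ s₁ = contradiction s₁ ¬s₁
    ... | no ¬s₁ | inj₂ s₂ with proj₁ (represents₂ M CM x) s₂
    ...   | y , g = y , inj₂ (¬s₁ ∘ to (Sat-weaken M ψ₁ x y) , g)

    eliminate : ∃ (λ y → Sat₀ M H (x ++ y)) → Sat₀ M (or ψ₁ ψ₂) x
    eliminate (y , inj₁ g)       = inj₁ (proj₂ (represents₁ M CM x) (y , g))
    eliminate (y , inj₂ (_ , g)) = inj₂ (proj₂ (represents₂ M CM x) (y , g))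

  unique : UniqueWitness C H
  unique M CM x y y′ (inj₁ g)        (inj₁ g′)        = unique₁ M CM x y y′ g g′
  unique M CM x y y′ (inj₂ (_ , g))  (inj₂ (_ , g′))  = unique₂ M CM x y y′ g g′
  unique M CM x y y′ (inj₁ g)        (inj₂ (¬s₁ , _)) =
    contradiction (from (Sat-weaken M ψ₁ x y′) (proj₂ (represents₁ M CM x) (y , g))) ¬s₁
  unique M CM x y y′ (inj₂ (¬s₁ , _)) (inj₁ g′)       =
    contradiction (from (Sat-weaken M ψ₁ x y) (proj₂ (represents₁ M CM x) (y′ , g′))) ¬s₁

  H⊆G₁∪G₂ : ∀ M y → Fibre M H y ⊆ Fibre M G₁ y ∪ Fibre M G₂ y
  H⊆G₁∪G₂ M y = Sum.map₂ proj₂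

  bounded : BoundedFibres C H
  bounded = N₁ + N₂ , λ M CM y →
    AtMost-⊆ _≗_ (λ {x} → H⊆G₁∪G₂ M y {x})
      (AtMost-∪ _≗_ {P = Fibre M G₁ y} {Q = Fibre M G₂ y} (bounded₁ M CM y) (bounded₂ M CM y))

IsReparam-ff : {C : Chain m → Set} → IsReparam {n = n} {d = D} C ff ff
IsReparam-ff =
  (λ M CM x → (λ ()) , λ ()) , (λ M CM x y y′ ()) , 0 , λ M CM y xs xs∈ff → ⊥-elim (xs∈ff zero)

disjunction : (Fin k → Formula m n 0) → (Fin k → Formula m (n + D) 0) → Formula m (n + D) 0
disjunction {k = zero}  ψ G = ff
disjunction {k = suc k} ψ G = orElse (ψ zero) (G zero) (disjunction (ψ ∘ suc) (G ∘ suc))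

IsReparam-disjunction : ExcludedMiddle 0ℓ → {C : Chain m → Set}
                        (ψ : Fin k → Formula m n 0) (G : Fin k → Formula m (n + D) 0) →
                        (∀ j → IsReparam C (ψ j) (G j)) → IsReparam C (⋁ ψ) (disjunction ψ G)
IsReparam-disjunction {k = zero}  lem ψ G R = IsReparam-ff
IsReparam-disjunction {k = suc k} lem ψ G R =
  IsReparam-or lem (ψ zero) (⋁ (ψ ∘ suc)) (G zero) (disjunction (ψ ∘ suc) (G ∘ suc))
    (R zero) (IsReparam-disjunction lem (ψ ∘ suc) (G ∘ suc) (R ∘ suc))

≤-maxF : (d : Fin k → ℕ) (j : Fin k) → d j ≤ maxF d
≤-maxF d zero    = m≤m⊔n (d zero) (maxF (d ∘ suc))
≤-maxF d (suc j) = ≤-trans (≤-maxF (d ∘ suc) j) (m≤n⊔m (d zero) (maxF (d ∘ suc)))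

lemma6 : ∀ {m n k} (d : Fin k → ℕ) → 1 ≤ n →
    Σ ((Fin k → Formula m n 0) → ((j : Fin k) → Formula m (n + d j) 0)
         → Formula m (n + maxF d) 0) λ F →
      ExcludedMiddle 0ℓ →
      ∀ (C : Chain m → Set) → (∀ M → C M → Countable M) →
      ∀ (ψ : Fin k → Formula m n 0) (G : (j : Fin k) → Formula m (n + d j) 0) →
      (∀ j → IsReparam C (ψ j) (G j)) →
      IsReparam C (⋁ ψ) (F ψ G)
lemma6 {n = n} d 1≤n =
  (λ ψ G → disjunction ψ (λ j → widen x₀ (≤-maxF d j) (G j))) ,
  λ lem C _ ψ G R →
    IsReparam-disjunction lem ψ _ λ j → IsReparam-widen x₀ (≤-maxF d j) (ψ j) (G j) (R j)
  where
  x₀ : Fin n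
  x₀ = fromℕ< 1≤n
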